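{- Let $(a(n))_{n\ge 0}$ be the integer sequence defined by $a(0)=1$, $a(1)=1$, and $a(n+1)=\sum_{p=0}^{n} a(p)\,a(n-p) - 1$ for all $n\ge 1$. Then for every integer $n\ge 4$, \[ (n+1)\,a(n) + 2(-3n+1)\,a(n-1) + (9n-13)\,a(n-2) - 4\,a(n-3) + 4(-n+4)\,a(n-4) = 0. \] -}

module Defs where

open import Data.Nat using (ℕ; zero; suc)
open import Data.Integer using (ℤ; +_; _+_; _*_; _-_)
open import Data.List using (List; []; _∷_; _∷ʳ_; reverse; zipWith; foldr)

conv : List ℤ → ℤ
conv xs = foldr _+_ (+ 0) (zipWith _*_ xs (reverse xs))

lastOr : ℤ → List ℤ → ℤ
lastOr d [] = d
lastOr d (x ∷ xs) = lastOr x xs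

-- prefix n = [a(0), a(1), …, a(n)]
prefix : ℕ → List ℤ
prefix zero = + 1 ∷ []
prefix (suc zero) = + 1 ∷ + 1 ∷ []
prefix (suc (suc n)) = prefix (suc n) ∷ʳ (conv (prefix (suc n)) - + 1)

a : ℕ → ℤ
a n = lastOr (+ 0) (prefix n)

private
  open import Relation.Binary.PropositionalEquality using (_≡_; refl)
  t3 : a 3 ≡ + 2
  t3 = refl
  t4 : a 4 ≡ + 5
  t4 = refl
  t5 : a 5 ≡ + 14
  t5 = refl

-- The generating series A = Σ a(n) xⁿ satisfies x A² = A − c with c = (1 − x − x²)/(1 − x),
-- which is the defining recurrence read coefficientwise. The Euler operator θ = x d/dx is a
-- derivation, so x A² + 2x A θA = θA − θc. As (1 − 2xA)² = 1 − 4xc modulo the quadratic,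
-- multiplying this by 1 − 2xA eliminates A² and leaves the linear equation
-- (1 − 4xc) θA + (1 − 2xc + 2xθc) A = c + θc. Multiplying by (1 − x)² makes all coefficients
-- polynomials, and the coefficient of x^(n+4) of the result is the recurrence.
module Submission where

open import Defs
open import Data.Nat using (ℕ)
open import Data.Integer using (ℤ; +_; _+_; _*_; _-_; -_)
open import Relation.Binary.PropositionalEquality using (_≡_)

open import Algebra.Bundles using (CommutativeRing)
import Algebra.Construct.Pointwise as Pointwise
open import Algebra.Solver.Ring.AlmostCommutativeRing
  using (fromCommutativeRing; _-Raw-AlmostCommutative⟶_)
import Algebra.Solver.Ring
open import Data.Integer using (_≟_; +-*-rawRing)
import Data.Integer.Properties as ℤ
open import Data.Integer.Tactic.RingSolver using (solve-∀)
open import Data.List using ([]; _∷_; _∷ʳ_; applyUpTo; applyDownFrom; foldr; zipWith)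
open import Data.List.Properties using (applyUpTo-∷ʳ; reverse-applyUpTo)
open import Data.Maybe using (Maybe; just; nothing)
open import Data.Nat as ℕ using (zero; suc)
open import Data.Nat.Properties using (+-comm)
open import Data.Product using (_,_)
open import Function using (_∘_)
open import Level using (0ℓ)
open import Relation.Binary.Core using (Rel)
open import Relation.Binary.PropositionalEquality
  using (refl; sym; trans; cong; cong₂; module ≡-Reasoning)
import Relation.Binary.Reasoning.Setoid as SetoidReasoning
open import Relation.Nullary using (yes; no)

-- The ring ℤ[[x]]

Series : Set
Series = ℕ → ℤ

infix  4 _≋_
infixl 6 _⊕_ _⊖_
infixl 7 _⊛_ _∙_
infix  8 ⊖_

_≋_ : Rel Series 0ℓ
f ≋ g = ∀ n → f n ≡ g n

≋-trans : ∀ {f g h} → f ≋ g → g ≋ h → f ≋ h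
≋-trans f≋g g≋h n = trans (f≋g n) (g≋h n)

tail : Series → Series
tail f = f ∘ suc

𝟘 : Series
𝟘 _ = + 0

const : ℤ → Series
const k zero    = k
const k (suc _) = + 0

𝟙 : Series
𝟙 = const (+ 1)

X : Series
X zero    = + 0
X (suc n) = 𝟙 n

_⊕_ : Series → Series → Series
(f ⊕ g) n = f n + g n

⊖_ : Series → Series
(⊖ f) n = - f n

_⊖_ : Series → Series → Series
f ⊖ g = f ⊕ ⊖ g

_∙_ : ℤ → Series → Series
(k ∙ f) n = k * f n

_⊛_ : Series → Series → Series
(f ⊛ g) zero    = f 0 * g 0
(f ⊛ g) (suc n) = f 0 * g (suc n) + (tail f ⊛ g) n

⊕-congˡ : ∀ f {g g′} → g ≋ g′ → f ⊕ g ≋ f ⊕ g′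
⊕-congˡ f g≋g′ n = cong (_+_ (f n)) (g≋g′ n)

⊛-congˡ : ∀ {f f′} g → f ≋ f′ → f ⊛ g ≋ f′ ⊛ g
⊛-congˡ g f≋f′ zero    = cong (_* g 0) (f≋f′ 0)
⊛-congˡ g f≋f′ (suc n) =
  cong₂ _+_ (cong (_* g (suc n)) (f≋f′ 0)) (⊛-congˡ g (f≋f′ ∘ suc) n)

⊛-congʳ : ∀ f {g g′} → g ≋ g′ → f ⊛ g ≋ f ⊛ g′
⊛-congʳ f g≋g′ zero    = cong (f 0 *_) (g≋g′ 0)
⊛-congʳ f g≋g′ (suc n) =
  cong₂ _+_ (cong (f 0 *_) (g≋g′ (suc n))) (⊛-congʳ (tail f) g≋g′ n)

⊛-zeroˡ : ∀ f → 𝟘 ⊛ f ≋ 𝟘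
⊛-zeroˡ f zero    = ℤ.*-zeroˡ (f 0)
⊛-zeroˡ f (suc n) = cong₂ _+_ (ℤ.*-zeroˡ (f (suc n))) (⊛-zeroˡ f n)

∙-⊛-assoc : ∀ k f g → (k ∙ f) ⊛ g ≋ k ∙ (f ⊛ g)
∙-⊛-assoc k f g zero    = ℤ.*-assoc k (f 0) (g 0)
∙-⊛-assoc k f g (suc n) =
  trans (cong₂ _+_ (ℤ.*-assoc k (f 0) (g (suc n))) (∙-⊛-assoc k (tail f) g n))
        (sym (ℤ.*-distribˡ-+ k _ _))

const-⊛ : ∀ k f → const k ⊛ f ≋ k ∙ f
const-⊛ k f zero    = refl
const-⊛ k f (suc n) =
  trans (cong (_+_ (k * f (suc n))) (⊛-zeroˡ f n)) (ℤ.+-identityʳ (k * f (suc n)))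

⊛-identityˡ : ∀ f → 𝟙 ⊛ f ≋ f
⊛-identityˡ f n = trans (const-⊛ (+ 1) f n) (ℤ.*-identityˡ (f n))

⊛-distribʳ : ∀ f g h → (f ⊕ g) ⊛ h ≋ f ⊛ h ⊕ g ⊛ h
⊛-distribʳ f g h zero    = ℤ.*-distribʳ-+ (h 0) (f 0) (g 0)
⊛-distribʳ f g h (suc n) = begin
  (f 0 + g 0) * h (suc n) + ((tail f ⊕ tail g) ⊛ h) n
    ≡⟨ cong (_+_ ((f 0 + g 0) * h (suc n))) (⊛-distribʳ (tail f) (tail g) h n) ⟩
  (f 0 + g 0) * h (suc n) + ((tail f ⊛ h) n + (tail g ⊛ h) n)
    ≡⟨ regroup (f 0) (g 0) (h (suc n)) _ _ ⟩
  (f 0 * h (suc n) + (tail f ⊛ h) n) + (g 0 * h (suc n) + (tail g ⊛ h) n) ∎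
  where
  open ≡-Reasoning
  regroup : ∀ x y z u v → (x + y) * z + (u + v) ≡ (x * z + u) + (y * z + v)
  regroup = solve-∀

⊛-sucʳ : ∀ f g n → (f ⊛ g) (suc n) ≡ (f ⊛ tail g) n + f (suc n) * g 0
⊛-sucʳ f g zero    = refl
⊛-sucʳ f g (suc n) =
  trans (cong (_+_ (f 0 * g (suc (suc n)))) (⊛-sucʳ (tail f) g n))
        (sym (ℤ.+-assoc (f 0 * g (suc (suc n))) _ _))

⊛-comm : ∀ f g → f ⊛ g ≋ g ⊛ f
⊛-comm f g zero    = ℤ.*-comm (f 0) (g 0)
⊛-comm f g (suc n) = begin
  f 0 * g (suc n) + (tail f ⊛ g) n
    ≡⟨ cong₂ _+_ (ℤ.*-comm (f 0) (g (suc n))) (⊛-comm (tail f) g n) ⟩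
  g (suc n) * f 0 + (g ⊛ tail f) n
    ≡⟨ ℤ.+-comm (g (suc n) * f 0) _ ⟩
  (g ⊛ tail f) n + g (suc n) * f 0
    ≡⟨ ⊛-sucʳ g f n ⟨
  (g ⊛ f) (suc n) ∎
  where open ≡-Reasoning

⊛-zeroʳ : ∀ f → f ⊛ 𝟘 ≋ 𝟘
⊛-zeroʳ f n = trans (⊛-comm f 𝟘 n) (⊛-zeroˡ f n)

⊛-assoc : ∀ f g h → (f ⊛ g) ⊛ h ≋ f ⊛ (g ⊛ h)
⊛-assoc f g h zero    = ℤ.*-assoc (f 0) (g 0) (h 0)
⊛-assoc f g h (suc n) = begin
  f 0 * g 0 * h (suc n) + (tail (f ⊛ g) ⊛ h) n
    ≡⟨ cong (_+_ (f 0 * g 0 * h (suc n))) (⊛-distribʳ (f 0 ∙ tail g) (tail f ⊛ g) h n) ⟩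
  f 0 * g 0 * h (suc n) + (((f 0 ∙ tail g) ⊛ h) n + ((tail f ⊛ g) ⊛ h) n)
    ≡⟨ cong₂ (λ u v → f 0 * g 0 * h (suc n) + (u + v)) (∙-⊛-assoc (f 0) (tail g) h n)
                                                         (⊛-assoc (tail f) g h n) ⟩
  f 0 * g 0 * h (suc n) + (f 0 * (tail g ⊛ h) n + (tail f ⊛ (g ⊛ h)) n)
    ≡⟨ regroup (f 0) (g 0) (h (suc n)) _ _ ⟩
  f 0 * (g 0 * h (suc n) + (tail g ⊛ h) n) + (tail f ⊛ (g ⊛ h)) n ∎
  where
  open ≡-Reasoning
  regroup : ∀ x y z u v → x * y * z + (x * u + v) ≡ x * (y * z + u) + v
  regroup = solve-∀

seriesRing : CommutativeRing 0ℓ 0ℓ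
seriesRing = record
  { Carrier           = Series
  ; _≈_               = _≋_
  ; _+_               = _⊕_
  ; _*_               = _⊛_
  ; -_                = ⊖_
  ; 0#                = 𝟘
  ; 1#                = 𝟙
  ; isCommutativeRing = record
    { isRing = record
      { +-isAbelianGroup = Pointwise.isAbelianGroup ℕ ℤ.+-0-isAbelianGroup
      ; *-cong           = λ {f} {f′} {g} f≋f′ g≋g′ n →
                             trans (⊛-congˡ g f≋f′ n) (⊛-congʳ f′ g≋g′ n)
      ; *-assoc          = ⊛-assoc
      ; *-identity       = ⊛-identityˡ , ⊛-identityʳ
      ; distrib          = ⊛-distribˡ , λ h f g → ⊛-distribʳ f g h
      }
    ; *-comm = ⊛-comm
    }
  }
  where
  ⊛-identityʳ : ∀ f → f ⊛ 𝟙 ≋ f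
  ⊛-identityʳ f n = trans (⊛-comm f 𝟙 n) (⊛-identityˡ f n)

  ⊛-distribˡ : ∀ f g h → f ⊛ (g ⊕ h) ≋ f ⊛ g ⊕ f ⊛ h
  ⊛-distribˡ f g h n = begin
    (f ⊛ (g ⊕ h)) n            ≡⟨ ⊛-comm f (g ⊕ h) n ⟩
    ((g ⊕ h) ⊛ f) n            ≡⟨ ⊛-distribʳ g h f n ⟩
    (g ⊛ f) n + (h ⊛ f) n      ≡⟨ cong₂ _+_ (⊛-comm g f n) (⊛-comm h f n) ⟩
    (f ⊛ g) n + (f ⊛ h) n      ∎
    where open ≡-Reasoning

const-homomorphism : +-*-rawRing -Raw-AlmostCommutative⟶ fromCommutativeRing seriesRing
const-homomorphism = record
  { ⟦_⟧    = const
  ; +-homo = λ { j k zero → refl ; j k (suc n) → refl }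
  ; *-homo = λ j k n → sym (trans (const-⊛ j (const k) n) (∙-const j k n))
  ; -‿homo = λ { k zero → refl ; k (suc n) → refl }
  ; 0-homo = λ { zero → refl ; (suc n) → refl }
  ; 1-homo = λ { zero → refl ; (suc n) → refl }
  }
  where
  ∙-const : ∀ j k → j ∙ const k ≋ const (j * k)
  ∙-const j k zero    = refl
  ∙-const j k (suc n) = ℤ.*-zeroʳ j

const-≟ : ∀ j k → Maybe (const j ≋ const k)
const-≟ j k with j ≟ k
... | yes refl = just λ _ → refl
... | no _     = nothing

module SeriesSolver =
  Algebra.Solver.Ring +-*-rawRing (fromCommutativeRing seriesRing) const-homomorphism const-≟

X⊛-suc : ∀ f n → (X ⊛ f) (suc n) ≡ f n
X⊛-suc f n = trans (cong₂ _+_ (ℤ.*-zeroˡ (f (suc n))) (⊛-identityˡ f n)) (ℤ.+-identityˡ (f n))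

𝟙⊖X⊛-suc : ∀ f n → ((𝟙 ⊖ X) ⊛ f) (suc n) ≡ f (suc n) - f n
𝟙⊖X⊛-suc f n = trans (distribute X f (suc n)) (cong (λ u → f (suc n) - u) (X⊛-suc f n))
  where
  open SeriesSolver
  distribute : ∀ x f → (𝟙 ⊖ x) ⊛ f ≋ f ⊖ x ⊛ f
  distribute = solve 2 (λ x f → (con (+ 1) :- x) :* f := f :- x :* f) (λ _ → refl)

-- The Euler operator

θ : Series → Series
θ f n = + n * f n

θ-cong : ∀ {f g} → f ≋ g → θ f ≋ θ g
θ-cong f≋g n = cong (+ n *_) (f≋g n)

θ-⊖ : ∀ f g → θ (f ⊖ g) ≋ θ f ⊖ θ g
θ-⊖ f g n = distrib (+ n) (f n) (g n)
  where
  distrib : ∀ k x y → k * (x - y) ≡ k * x - k * y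
  distrib = solve-∀

tail-θ : ∀ f → tail (θ f) ≋ θ (tail f) ⊕ tail f
tail-θ f n = suc-* (+ n) (f (suc n))
  where
  suc-* : ∀ k x → (+ 1 + k) * x ≡ k * x + x
  suc-* = solve-∀

θ-leibniz : ∀ f g → θ (f ⊛ g) ≋ θ f ⊛ g ⊕ f ⊛ θ g
θ-leibniz f g zero    = zero-case (f 0) (g 0)
  where
  zero-case : ∀ x y → + 0 * (x * y) ≡ + 0 * x * y + x * (+ 0 * y)
  zero-case = solve-∀
θ-leibniz f g (suc n) = begin
  + suc n * (f 0 * g (suc n) + (tail f ⊛ g) n)
    ≡⟨ expand (+ n) (f 0) (g (suc n)) ((tail f ⊛ g) n) ⟩
  + n * (tail f ⊛ g) n + (tail f ⊛ g) n + f 0 * θ g (suc n)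
    ≡⟨ cong (λ u → u + (tail f ⊛ g) n + f 0 * θ g (suc n)) (θ-leibniz (tail f) g n) ⟩
  (θ (tail f) ⊛ g) n + (tail f ⊛ θ g) n + (tail f ⊛ g) n + f 0 * θ g (suc n)
    ≡⟨ regroup (f 0) (g (suc n)) ((θ (tail f) ⊛ g) n) ((tail f ⊛ θ g) n)
                                 ((tail f ⊛ g) n) (f 0 * θ g (suc n)) ⟩
  θ f 0 * g (suc n) + ((θ (tail f) ⊛ g) n + (tail f ⊛ g) n)
                    + (f 0 * θ g (suc n) + (tail f ⊛ θ g) n)
    ≡⟨ cong (λ u → θ f 0 * g (suc n) + u + (f 0 * θ g (suc n) + (tail f ⊛ θ g) n))
            tail-θf⊛g ⟨
  θ f 0 * g (suc n) + (tail (θ f) ⊛ g) n + (f 0 * θ g (suc n) + (tail f ⊛ θ g) n) ∎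
  where
  open ≡-Reasoning
  expand : ∀ k x y w → (+ 1 + k) * (x * y + w) ≡ k * w + w + x * ((+ 1 + k) * y)
  expand = solve-∀
  regroup : ∀ x y p q r s → p + q + r + s ≡ + 0 * x * y + (p + r) + (s + q)
  regroup = solve-∀
  tail-θf⊛g : (tail (θ f) ⊛ g) n ≡ (θ (tail f) ⊛ g) n + (tail f ⊛ g) n
  tail-θf⊛g = trans (⊛-congˡ g (tail-θ f) n) (⊛-distribʳ (θ (tail f)) (tail f) g n)

θ-X : θ X ≋ X
θ-X zero          = refl
θ-X (suc zero)    = refl
θ-X (suc (suc n)) = ℤ.*-zeroʳ (+ suc (suc n))

θ-X⊛ : ∀ f → θ (X ⊛ f) ≋ X ⊛ f ⊕ X ⊛ θ f
θ-X⊛ f n = trans (θ-leibniz X f n) (cong (λ u → u + (X ⊛ θ f) n) (⊛-congˡ f θ-X n))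

⊖≋𝟘 : ∀ {p q} → p ≋ q → p ⊖ q ≋ 𝟘
⊖≋𝟘 {p} p≋q n = trans (cong (λ u → p n - u) (sym (p≋q n))) (ℤ.+-inverseʳ (p n))

⊛-⊖≋𝟘 : ∀ {p q} → p ≋ q → ∀ {m} → m ⊛ (p ⊖ q) ≋ 𝟘
⊛-⊖≋𝟘 p≋q {m} n = trans (⊛-congʳ m (⊖≋𝟘 p≋q) n) (⊛-zeroʳ m n)

⊕-⊛-⊖≋ : ∀ {p q} → p ≋ q → ∀ {r m} → r ⊕ m ⊛ (p ⊖ q) ≋ r
⊕-⊛-⊖≋ p≋q {r} n = trans (cong (_+_ (r n)) (⊛-⊖≋𝟘 p≋q n)) (ℤ.+-identityʳ (r n))

first-order-ode : ∀ x A B c t →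
  x ⊛ (A ⊛ A) ≋ A ⊖ c →
  x ⊛ (A ⊛ A) ⊕ x ⊛ (B ⊛ A ⊕ A ⊛ B) ≋ B ⊖ t →
  (𝟙 ⊖ const (+ 4) ⊛ x ⊛ c) ⊛ B ⊕ (𝟙 ⊖ const (+ 2) ⊛ x ⊛ c ⊕ const (+ 2) ⊛ x ⊛ t) ⊛ A ≋ c ⊕ t
first-order-ode x A B c t quadratic derivative =
  ≋-trans
    (solve 5 (λ x A B c t →
        (con (+ 1) :- con (+ 4) :* x :* c) :* B
          :+ (con (+ 1) :- con (+ 2) :* x :* c :+ con (+ 2) :* x :* t) :* A
      := c :+ t
         :+ :- (con (+ 1) :+ con (+ 2) :* x :* A :+ con (+ 4) :* x :* B)
            :* (x :* (A :* A) :- (A :- c))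
         :+ (con (+ 2) :* x :* A :- con (+ 1))
            :* (x :* (A :* A) :+ x :* (B :* A :+ A :* B) :- (B :- t)))
      (λ _ → refl) x A B c t)
    (≋-trans (⊕-⊛-⊖≋ derivative) (⊕-⊛-⊖≋ quadratic))
  where open SeriesSolver

horner : Series → Series → Series → Series → Series → Series → Series
horner x p₀ p₁ p₂ p₃ p₄ = p₀ ⊕ x ⊛ (p₁ ⊕ x ⊛ (p₂ ⊕ x ⊛ (p₃ ⊕ x ⊛ p₄)))

row : ℤ → ℤ → ℤ → Series → Series → Series
row β α γ A B = const β ⊛ B ⊕ const α ⊛ A ⊕ const γ

-- (1 − 6x + 9x² − 4x⁴) B + (1 − 4x + 5x² − 4x³) A − (1 − 2x − 2x² + 2x³) in Horner form;
-- the row for xⁱ lists the coefficients of B, A and 1.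
ode : Series → Series → Series → Series
ode x A B = horner x (row (+ 1)   (+ 1)   (- + 1) A B)
                     (row (- + 6) (- + 4) (+ 2)   A B)
                     (row (+ 9)   (+ 5)   (+ 2)   A B)
                     (row (+ 0)   (- + 4) (- + 2) A B)
                     (const (- + 4) ⊛ B)

polynomial-ode : ∀ x A B c t →
  (𝟙 ⊖ x) ⊛ c ≋ 𝟙 ⊖ x ⊛ (𝟙 ⊕ x) →
  (𝟙 ⊖ x) ⊛ ((𝟙 ⊖ x) ⊛ t) ≋ x ⊛ (x ⊛ (x ⊖ const (+ 2))) →
  (𝟙 ⊖ const (+ 4) ⊛ x ⊛ c) ⊛ B ⊕ (𝟙 ⊖ const (+ 2) ⊛ x ⊛ c ⊕ const (+ 2) ⊛ x ⊛ t) ⊛ A ≋ c ⊕ t →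
  ode x A B ≋ 𝟘
polynomial-ode x A B c t c-rational t-rational first-order =
  ≋-trans
    (solve 5 (λ x A B c t →
        con (+ 1)   :* B :+ con (+ 1)   :* A :+ con (- + 1) :+ x :* (
        con (- + 6) :* B :+ con (- + 4) :* A :+ con (+ 2)   :+ x :* (
        con (+ 9)   :* B :+ con (+ 5)   :* A :+ con (+ 2)   :+ x :* (
        con (+ 0)   :* B :+ con (- + 4) :* A :+ con (- + 2) :+ x :* (
        con (- + 4) :* B))))
      := (con (+ 1) :- x) :* (con (+ 1) :- x)
            :* ((con (+ 1) :- con (+ 4) :* x :* c) :* B
                :+ (con (+ 1) :- con (+ 2) :* x :* c :+ con (+ 2) :* x :* t) :* A :- (c :+ t))
         :+ (con (+ 4) :* x :* (con (+ 1) :- x) :* B :+ con (+ 2) :* x :* (con (+ 1) :- x) :* A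
             :+ (con (+ 1) :- x))
            :* ((con (+ 1) :- x) :* c :- (con (+ 1) :- x :* (con (+ 1) :+ x)))
         :+ (con (+ 1) :- con (+ 2) :* x :* A)
            :* ((con (+ 1) :- x) :* ((con (+ 1) :- x) :* t) :- x :* (x :* (x :- con (+ 2)))))
      (λ _ → refl) x A B c t)
    (≋-trans (⊕-⊛-⊖≋ t-rational) (≋-trans (⊕-⊛-⊖≋ c-rational) (⊛-⊖≋𝟘 first-order)))
  where open SeriesSolver

-- The generating series of a

lastOr-∷ʳ : ∀ d xs x → lastOr d (xs ∷ʳ x) ≡ x
lastOr-∷ʳ d []       x = refl
lastOr-∷ʳ d (y ∷ xs) x = lastOr-∷ʳ y xs x

prefix≡applyUpTo : ∀ n → prefix n ≡ applyUpTo a (suc n)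
prefix≡applyUpTo zero          = refl
prefix≡applyUpTo (suc zero)    = refl
prefix≡applyUpTo (suc (suc n)) = begin
  prefix (suc n) ∷ʳ x
    ≡⟨ cong₂ _∷ʳ_ (prefix≡applyUpTo (suc n)) (sym (lastOr-∷ʳ (+ 0) (prefix (suc n)) x)) ⟩
  applyUpTo a (suc (suc n)) ∷ʳ a (suc (suc n))
    ≡⟨ applyUpTo-∷ʳ a (suc (suc n)) ⟩
  applyUpTo a (suc (suc (suc n))) ∎
  where
  open ≡-Reasoning
  x : ℤ
  x = conv (prefix (suc n)) - + 1

foldr-zipWith≡⊛ : ∀ f g n →
  foldr _+_ (+ 0) (zipWith _*_ (applyUpTo f (suc n)) (applyDownFrom g (suc n))) ≡ (f ⊛ g) n
foldr-zipWith≡⊛ f g zero    = ℤ.+-identityʳ (f 0 * g 0)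
foldr-zipWith≡⊛ f g (suc n) = cong (_+_ (f 0 * g (suc n))) (foldr-zipWith≡⊛ (tail f) g n)

conv-prefix : ∀ n → conv (prefix n) ≡ (a ⊛ a) n
conv-prefix n rewrite prefix≡applyUpTo n | reverse-applyUpTo a (suc n) = foldr-zipWith≡⊛ a a n

a-recurrence : ∀ n → a (suc (suc n)) ≡ (a ⊛ a) (suc n) - + 1
a-recurrence n =
  trans (lastOr-∷ʳ (+ 0) (prefix (suc n)) _) (cong (λ u → u - + 1) (conv-prefix (suc n)))

c : Series
c zero          = + 1
c (suc zero)    = + 0
c (suc (suc _)) = - + 1

a-quadratic : X ⊛ (a ⊛ a) ≋ a ⊖ c
a-quadratic zero          = refl
a-quadratic (suc zero)    = refl
a-quadratic (suc (suc n)) = begin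
  (X ⊛ (a ⊛ a)) (suc (suc n))       ≡⟨ X⊛-suc (a ⊛ a) (suc n) ⟩
  (a ⊛ a) (suc n)                   ≡⟨ undo ((a ⊛ a) (suc n)) ⟩
  (a ⊛ a) (suc n) - + 1 - - + 1     ≡⟨ cong (λ u → u - - + 1) (a-recurrence n) ⟨
  a (suc (suc n)) - c (suc (suc n)) ∎
  where
  open ≡-Reasoning
  undo : ∀ x → x ≡ x - + 1 - - + 1
  undo = solve-∀

a-θ-quadratic : X ⊛ (a ⊛ a) ⊕ X ⊛ (θ a ⊛ a ⊕ a ⊛ θ a) ≋ θ a ⊖ θ c
a-θ-quadratic = begin
  X ⊛ (a ⊛ a) ⊕ X ⊛ (θ a ⊛ a ⊕ a ⊛ θ a) ≈⟨ ⊕-congˡ (X ⊛ (a ⊛ a)) (⊛-congʳ X (θ-leibniz a a)) ⟨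
  X ⊛ (a ⊛ a) ⊕ X ⊛ θ (a ⊛ a)           ≈⟨ θ-X⊛ (a ⊛ a) ⟨
  θ (X ⊛ (a ⊛ a))                       ≈⟨ θ-cong a-quadratic ⟩
  θ (a ⊖ c)                             ≈⟨ θ-⊖ a c ⟩
  θ a ⊖ θ c                             ∎
  where open SetoidReasoning (CommutativeRing.setoid seriesRing)

c-rational : (𝟙 ⊖ X) ⊛ c ≋ 𝟙 ⊖ X ⊛ (𝟙 ⊕ X)
c-rational zero                = refl
c-rational (suc zero)          = refl
c-rational (suc (suc zero))    = refl
c-rational (suc (suc (suc n))) =
  trans (𝟙⊖X⊛-suc c (suc (suc n))) (cong (λ u → + 0 - u) (sym (X⊛-suc (𝟙 ⊕ X) (suc (suc n)))))

θc-rational : (𝟙 ⊖ X) ⊛ ((𝟙 ⊖ X) ⊛ θ c) ≋ X ⊛ (X ⊛ (X ⊖ const (+ 2)))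
θc-rational zero                      = refl
θc-rational (suc zero)                = refl
θc-rational (suc (suc zero))          = refl
θc-rational (suc (suc (suc zero)))    = refl
θc-rational (suc (suc (suc (suc n)))) = begin
  ((𝟙 ⊖ X) ⊛ ((𝟙 ⊖ X) ⊛ θ c)) (4 ℕ.+ n)
    ≡⟨ 𝟙⊖X⊛-suc ((𝟙 ⊖ X) ⊛ θ c) (3 ℕ.+ n) ⟩
  ((𝟙 ⊖ X) ⊛ θ c) (4 ℕ.+ n) - ((𝟙 ⊖ X) ⊛ θ c) (3 ℕ.+ n)
    ≡⟨ cong₂ _-_ (𝟙⊖X⊛-suc (θ c) (3 ℕ.+ n)) (𝟙⊖X⊛-suc (θ c) (2 ℕ.+ n)) ⟩
  (θ c (4 ℕ.+ n) - θ c (3 ℕ.+ n)) - (θ c (3 ℕ.+ n) - θ c (2 ℕ.+ n))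
    ≡⟨ second-difference (+ n) ⟩
  + 0
    ≡⟨ trans (X⊛-suc (X ⊛ (X ⊖ const (+ 2))) (3 ℕ.+ n)) (X⊛-suc (X ⊖ const (+ 2)) (2 ℕ.+ n)) ⟨
  (X ⊛ (X ⊛ (X ⊖ const (+ 2)))) (4 ℕ.+ n) ∎
  where
  open ≡-Reasoning
  second-difference : ∀ k →
    ((+ 4 + k) * - + 1 - (+ 3 + k) * - + 1) - ((+ 3 + k) * - + 1 - (+ 2 + k) * - + 1) ≡ + 0
  second-difference = solve-∀

a-ode : ode X a (θ a) ≋ 𝟘
a-ode = polynomial-ode X a (θ a) c (θ c) c-rational θc-rational
          (first-order-ode X a (θ a) c (θ c) a-quadratic a-θ-quadratic)

horner-X : ∀ p₀ p₁ p₂ p₃ p₄ n → horner X p₀ p₁ p₂ p₃ p₄ (4 ℕ.+ n) ≡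
  p₀ (4 ℕ.+ n) + (p₁ (3 ℕ.+ n) + (p₂ (2 ℕ.+ n) + (p₃ (1 ℕ.+ n) + p₄ n)))
horner-X p₀ p₁ p₂ p₃ p₄ n =
  trans (⊕-X⊛-suc p₀ (p₁ ⊕ X ⊛ (p₂ ⊕ X ⊛ (p₃ ⊕ X ⊛ p₄))) (3 ℕ.+ n)) (cong (_+_ (p₀ (4 ℕ.+ n)))
  (trans (⊕-X⊛-suc p₁ (p₂ ⊕ X ⊛ (p₃ ⊕ X ⊛ p₄)) (2 ℕ.+ n)) (cong (_+_ (p₁ (3 ℕ.+ n)))
  (trans (⊕-X⊛-suc p₂ (p₃ ⊕ X ⊛ p₄) (1 ℕ.+ n)) (cong (_+_ (p₂ (2 ℕ.+ n)))
  (⊕-X⊛-suc p₃ p₄ n))))))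
  where
  ⊕-X⊛-suc : ∀ f g n → (f ⊕ X ⊛ g) (suc n) ≡ f (suc n) + g n
  ⊕-X⊛-suc f g n = cong (_+_ (f (suc n))) (X⊛-suc g n)

row-suc : ∀ β α γ A B n → row β α γ A B (suc n) ≡ β * B (suc n) + α * A (suc n)
row-suc β α γ A B n =
  trans (cong (_+ + 0) (cong₂ _+_ (const-⊛ β B (suc n)) (const-⊛ α A (suc n)))) (ℤ.+-identityʳ _)

ode-coefficient : ∀ A B n → ode X A B (4 ℕ.+ n) ≡
    (+ 1 * B (4 ℕ.+ n) + + 1 * A (4 ℕ.+ n))
  + ((- + 6 * B (3 ℕ.+ n) + - + 4 * A (3 ℕ.+ n))
  + ((+ 9 * B (2 ℕ.+ n) + + 5 * A (2 ℕ.+ n))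
  + ((+ 0 * B (1 ℕ.+ n) + - + 4 * A (1 ℕ.+ n))
  + - + 4 * B n)))
ode-coefficient A B n = trans
  (horner-X (row (+ 1) (+ 1) (- + 1) A B) (row (- + 6) (- + 4) (+ 2) A B)
            (row (+ 9) (+ 5) (+ 2) A B) (row (+ 0) (- + 4) (- + 2) A B) (const (- + 4) ⊛ B) n)
  (cong₂ _+_ (row-suc (+ 1) (+ 1) (- + 1) A B (3 ℕ.+ n))
  (cong₂ _+_ (row-suc (- + 6) (- + 4) (+ 2) A B (2 ℕ.+ n))
  (cong₂ _+_ (row-suc (+ 9) (+ 5) (+ 2) A B (1 ℕ.+ n))
  (cong₂ _+_ (row-suc (+ 0) (- + 4) (- + 2) A B n) (const-⊛ (- + 4) B n)))))

-- m + 1 is rewritten first: once m + 4 has become 4 + m, the term + n + + 1 normalises to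
-- + (4 + (m + 1)), which must be left alone.
theorem1 : (m : ℕ) → let n = m Data.Nat.+ 4 in
    (+ n + + 1) * a n + + 2 * (- (+ 3 * + n) + + 1) * a (m Data.Nat.+ 3)
      + (+ 9 * + n - + 13) * a (m Data.Nat.+ 2) - + 4 * a (m Data.Nat.+ 1)
      + + 4 * (- + n + + 4) * a m ≡ + 0
theorem1 m rewrite +-comm m 1 | +-comm m 2 | +-comm m 3 | +-comm m 4 = begin
  _ ≡⟨ regroup (+ m) (a (4 ℕ.+ m)) (a (3 ℕ.+ m)) (a (2 ℕ.+ m)) (a (1 ℕ.+ m)) (a m) ⟩
  _ ≡⟨ ode-coefficient a (θ a) m ⟨
  ode X a (θ a) (4 ℕ.+ m) ≡⟨ a-ode (4 ℕ.+ m) ⟩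
  + 0 ∎
  where
  open ≡-Reasoning
  regroup : ∀ k a₄ a₃ a₂ a₁ a₀ →
      (+ 4 + k + + 1) * a₄ + + 2 * (- (+ 3 * (+ 4 + k)) + + 1) * a₃
      + (+ 9 * (+ 4 + k) - + 13) * a₂ - + 4 * a₁ + + 4 * (- (+ 4 + k) + + 4) * a₀
    ≡ (+ 1 * ((+ 4 + k) * a₄) + + 1 * a₄)
      + ((- + 6 * ((+ 3 + k) * a₃) + - + 4 * a₃)
      + ((+ 9 * ((+ 2 + k) * a₂) + + 5 * a₂)
      + ((+ 0 * ((+ 1 + k) * a₁) + - + 4 * a₁)
      + - + 4 * (k * a₀))))
  regroup = solve-∀
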